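{- The $(7,17,6)_2$ subspace codes of dimension distribution $(3^{16}5^1)$ are exactly the sets of the form $\mathcal{S}_{16}\cup\{F\}$, where $\mathcal{S}_{16}$ is a partial plane spread of size $16$ in $\mathrm{PG}(6,2)$ and $F$ is a $5$-dimensional subspace of $\mathbb{F}_2^7$ containing all holes of $\mathcal{S}_{16}$.
   Context: Subspace codes in $V=\mathbb{F}_2^7$ with subspace distance $d_S(U_1,U_2)=\dim U_1+\dim U_2-2\dim(U_1\cap U_2)$; a $(7,17,6)_2$ code is a set of $17$ subspaces with pairwise subspace distance at least $6$; dimension distribution $(3^{16}5^1)$ means sixteen codewords of dimension $3$ and one of dimension $5$. A partial plane spread is a set of $3$-dimensional subspaces pairwise intersecting in $\{0\}$; its holes are the $1$-dimensional subspaces not contained in any of its members. -}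

module Defs where

open import Data.Bool using (Bool; true; false; _xor_; _∧_; if_then_else_)
open import Data.Nat using (ℕ; _+_; _*_; _≤_)
open import Data.Fin using (Fin)
open import Data.Vec using (Vec; replicate; zipWith)
open import Data.Product using (Σ; _×_; ∃; ∃-syntax)
open import Data.Sum using (_⊎_)
open import Relation.Binary.PropositionalEquality using (_≡_; _≢_; refl)
open import Relation.Nullary using (¬_)
open import Function.Bundles using (_⇔_)

Vect : ℕ → Set
Vect n = Vec Bool n

𝟎 : ∀ {n} → Vect n
𝟎 = replicate _ false

_⊕_ : ∀ {n} → Vect n → Vect n → Vect n
_⊕_ = zipWith _xor_

-- A (linear) subspace of F₂ⁿ: a decidable subset containing 0 and closed
-- under addition (over F₂ scalar multiplication is trivial).
record Subspace (n : ℕ) : Set where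
  field
    mem      : Vect n → Bool
    mem-zero : mem 𝟎 ≡ true
    mem-add  : ∀ u v → mem u ≡ true → mem v ≡ true → mem (u ⊕ v) ≡ true
open Subspace public

_∈S_ : ∀ {n} → Vect n → Subspace n → Set
v ∈S U = mem U v ≡ true

_⊆S_ : ∀ {n} → Subspace n → Subspace n → Set
U ⊆S W = ∀ v → v ∈S U → v ∈S W

_≈S_ : ∀ {n} → Subspace n → Subspace n → Set
U ≈S W = ∀ v → mem U v ≡ mem W v

∧-true : ∀ {a b} → (a ∧ b) ≡ true → (a ≡ true) × (b ≡ true)
∧-true {true} {true} refl = refl Data.Product., refl

true-∧ : ∀ {a b} → a ≡ true → b ≡ true → (a ∧ b) ≡ true
true-∧ refl refl = refl

_∩S_ : ∀ {n} → Subspace n → Subspace n → Subspace n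
mem (U ∩S W) v = mem U v ∧ mem W v
mem-zero (U ∩S W) = true-∧ (mem-zero U) (mem-zero W)
mem-add (U ∩S W) u v pu pv =
  true-∧ (mem-add U u v (Data.Product.proj₁ (∧-true pu)) (Data.Product.proj₁ (∧-true pv)))
         (mem-add W u v (Data.Product.proj₂ (∧-true pu)) (Data.Product.proj₂ (∧-true pv)))

lincomb : ∀ {n} (k : ℕ) → (Fin k → Bool) → (Fin k → Vect n) → Vect n
lincomb ℕ.zero    s b = 𝟎
lincomb (ℕ.suc k) s b =
  (if s Fin.zero then b Fin.zero else 𝟎) ⊕ lincomb k (λ i → s (Fin.suc i)) (λ i → b (Fin.suc i))

LinIndep : ∀ {n k} → (Fin k → Vect n) → Set
LinIndep {k = k} b = ∀ s → lincomb k s b ≡ 𝟎 → ∀ i → s i ≡ false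

HasDim : ∀ {n} → Subspace n → ℕ → Set
HasDim {n} U k = Σ (Fin k → Vect n) λ b →
  LinIndep b × (∀ v → v ∈S U ⇔ (∃[ s ] lincomb k s b ≡ v))

-- Subspace distance d_S(U,W) = dim U + dim W - 2 dim(U ∩ W) is at least d
-- (stated without subtraction: d + 2 dim(U∩W) ≤ dim U + dim W).
DistAtLeast : ∀ {n} → ℕ → Subspace n → Subspace n → Set
DistAtLeast d U W = ∀ a b c → HasDim U a → HasDim W b → HasDim (U ∩S W) c →
  d + 2 * c ≤ a + b

-- An (n, m, d)_2 subspace code, given as an injective family (a set of m
-- distinct subspaces) with pairwise subspace distance ≥ d.
IsSubspaceCode : ∀ (n m d : ℕ) → (Fin m → Subspace n) → Set
IsSubspaceCode n m d C =
  (∀ i j → C i ≈S C j → i ≡ j) × (∀ i j → i ≢ j → DistAtLeast d (C i) (C j))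

DimDist3¹⁶5¹ : (Fin 17 → Subspace 7) → Set
DimDist3¹⁶5¹ C = Σ (Fin 17) λ j → HasDim (C j) 5 × (∀ i → i ≢ j → HasDim (C i) 3)

IsPartialPlaneSpread : ∀ {n} (m : ℕ) → (Fin m → Subspace n) → Set
IsPartialPlaneSpread m S =
  (∀ i → HasDim (S i) 3) ×
  (∀ i j → S i ≈S S j → i ≡ j) ×
  (∀ i j → i ≢ j → ∀ v → v ∈S S i → v ∈S S j → v ≡ 𝟎)

IsHole : ∀ {n m} → (Fin m → Subspace n) → Subspace n → Set
IsHole S P = HasDim P 1 × (∀ i → ¬ (P ⊆S S i))

SameSet : ∀ {n m m'} → (Fin m → Subspace n) → (Fin m' → Subspace n) → Subspace n → Set
SameSet C S F = ∀ U → (∃[ i ] C i ≈S U) ⇔ ((∃[ j ] S j ≈S U) ⊎ F ≈S U)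

-- Count vectors of F₂⁷. Sixteen planes meeting pairwise in 0 cover 1 + 16·7 = 113
-- vectors and leave 15 uncovered; the holes are the lines through these. A 5-space F
-- meets every plane in at least a point (5 + 3 > 7), and the planes cover
-- 1 + Σᵢ (|F ∩ Sᵢ| - 1) ≥ 17 of its 32 vectors. So F contains all holes iff it meets
-- every plane in exactly a point, which for dimensions 5 and 3 is subspace distance 6;
-- between planes, distance 6 means meeting in 0. What remains is to pass between the
-- indexed code C and the set S ∪ {F}.

module Submission where

open import Algebra.Bundles using (CommutativeSemigroup)
import Algebra.Properties.CommutativeSemigroup as CommutativeSemigroupProperties
open import Data.Bool using (Bool; true; false; not; _∧_; _∨_; _xor_; if_then_else_)
open import Data.Bool.Properties
  using ( xor-assoc; xor-comm; xor-identityˡ; xor-identityʳ; xor-same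
        ; ∧-comm; ∧-zeroʳ; ∧-distribˡ-∨; ⇔→≡)
  renaming (_≟_ to _≟ᴮ_)
open import Data.Empty using (⊥; ⊥-elim)
open import Data.Fin using (Fin; zero; suc; punchIn; punchOut; _≟_)
open import Data.Fin.Properties
  using (punchIn-injective; punchInᵢ≢i; punchIn-punchOut; punchOut-injective; injective⇒≤)
  renaming (suc-injective to Fin-suc-injective)
open import Data.Nat using (ℕ; zero; suc; _+_; _*_; _^_; _≤_; _<_; z≤n; s≤s; _≤?_)
open import Data.Nat.Properties hiding (_≟_)
open import Data.Product using (Σ; _×_; _,_; proj₁; proj₂; ∃; ∃-syntax)
open import Data.Sum using (_⊎_; inj₁; inj₂)
open import Data.Vec using ([]; _∷_)
open import Data.Vec.Functional using (tail) renaming (_∷_ to _◂_)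
open import Data.Vec.Properties
  using (zipWith-assoc; zipWith-comm; zipWith-identityˡ; zipWith-identityʳ; ≡-dec)
open import Function using (_∘_; case_of_)
open import Function.Bundles using (_⇔_; mk⇔; Equivalence)
open import Relation.Binary.Bundles using (Setoid)
open import Relation.Binary.PropositionalEquality
open import Relation.Binary.PropositionalEquality.Algebra using (isMagma)
open import Relation.Nullary using (¬_; yes; no; contradiction)
open import Algebra.Properties.Monoid.Sum +-0-monoid using (sum-syntax; sum-cong-≗)

open import Defs

private
  variable
    n m k : ℕ

-- The group (F₂ⁿ, ⊕)

⊕-assoc : (u v w : Vect n) → (u ⊕ v) ⊕ w ≡ u ⊕ (v ⊕ w)
⊕-assoc = zipWith-assoc xor-assoc

⊕-comm : (u v : Vect n) → u ⊕ v ≡ v ⊕ u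
⊕-comm = zipWith-comm xor-comm

⊕-identityˡ : (v : Vect n) → 𝟎 ⊕ v ≡ v
⊕-identityˡ = zipWith-identityˡ xor-identityˡ

⊕-identityʳ : (v : Vect n) → v ⊕ 𝟎 ≡ v
⊕-identityʳ = zipWith-identityʳ xor-identityʳ

⊕-self : (v : Vect n) → v ⊕ v ≡ 𝟎
⊕-self []      = refl
⊕-self (x ∷ v) = cong₂ _∷_ (xor-same x) (⊕-self v)

⊕-commutativeSemigroup : ℕ → CommutativeSemigroup _ _
⊕-commutativeSemigroup n = record
  { Carrier = Vect n
  ; _≈_     = _≡_
  ; _∙_     = _⊕_
  ; isCommutativeSemigroup = record
    { isSemigroup = record { isMagma = isMagma _⊕_ ; assoc = ⊕-assoc }
    ; comm        = ⊕-comm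
    }
  }

⊕-interchange : (a b c d : Vect n) → (a ⊕ b) ⊕ (c ⊕ d) ≡ (a ⊕ c) ⊕ (b ⊕ d)
⊕-interchange {n} = CommutativeSemigroupProperties.interchange (⊕-commutativeSemigroup n)

⊕-xy∙z≡y∙xz : (x y z : Vect n) → (x ⊕ y) ⊕ z ≡ y ⊕ (x ⊕ z)
⊕-xy∙z≡y∙xz {n} = CommutativeSemigroupProperties.xy∙z≈y∙xz (⊕-commutativeSemigroup n)

⊕-cancelˡ : (x y : Vect n) → x ⊕ (y ⊕ x) ≡ y
⊕-cancelˡ {n} x y = begin
  x ⊕ (y ⊕ x) ≡⟨ CommutativeSemigroupProperties.x∙yz≈y∙xz (⊕-commutativeSemigroup n) x y x ⟩
  y ⊕ (x ⊕ x) ≡⟨ cong (y ⊕_) (⊕-self x) ⟩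
  y ⊕ 𝟎       ≡⟨ ⊕-identityʳ y ⟩
  y           ∎
  where open ≡-Reasoning

⊕≡𝟎⇒≡ : (u v : Vect n) → u ⊕ v ≡ 𝟎 → u ≡ v
⊕≡𝟎⇒≡ u v u⊕v≡𝟎 = begin
  u           ≡⟨ sym (⊕-cancelˡ v u) ⟩
  v ⊕ (u ⊕ v) ≡⟨ cong (v ⊕_) u⊕v≡𝟎 ⟩
  v ⊕ 𝟎       ≡⟨ ⊕-identityʳ v ⟩
  v           ∎
  where open ≡-Reasoning

isZero : Vect n → Bool
isZero []      = true
isZero (x ∷ v) = not x ∧ isZero v

isZero-𝟎 : isZero (𝟎 {n}) ≡ true
isZero-𝟎 {zero}  = refl
isZero-𝟎 {suc n} = isZero-𝟎 {n}

isZero⇒≡𝟎 : (v : Vect n) → isZero v ≡ true → v ≡ 𝟎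
isZero⇒≡𝟎 []          _ = refl
isZero⇒≡𝟎 (false ∷ v) e = cong (false ∷_) (isZero⇒≡𝟎 v e)

isZero-⊕-self : (v : Vect n) → isZero (v ⊕ v) ≡ true
isZero-⊕-self {n} v = subst (λ w → isZero w ≡ true) (sym (⊕-self v)) (isZero-𝟎 {n})

Closed : (Vect n → Bool) → Set
Closed B = ∀ u v → B u ≡ true → B v ≡ true → B (u ⊕ v) ≡ true

isZero-closed : Closed (isZero {n})
isZero-closed {n} u v zu zv
  rewrite isZero⇒≡𝟎 u zu | isZero⇒≡𝟎 v zv | ⊕-self (𝟎 {n}) = isZero-𝟎 {n}

∨-elim : ∀ a b → (a ∨ b) ≡ true → a ≡ true ⊎ b ≡ true
∨-elim true  _ _ = inj₁ refl
∨-elim false _ e = inj₂ e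

∨-introˡ : ∀ {a} b → a ≡ true → (a ∨ b) ≡ true
∨-introˡ _ refl = refl

∨-introʳ : ∀ a {b} → b ≡ true → (a ∨ b) ≡ true
∨-introʳ true  _    = refl
∨-introʳ false refl = refl

not-true⇒false : ∀ {a} → not a ≡ true → a ≡ false
not-true⇒false {false} _ = refl

not-false⇒true : ∀ {a} → not a ≡ false → a ≡ true
not-false⇒true {true} _ = refl

-- Counting vectors

indicator : Bool → ℕ
indicator true  = 1
indicator false = 0

count : ∀ n → (Vect n → Bool) → ℕ
count zero    p = indicator (p [])
count (suc n) p = count n (p ∘ (true ∷_)) + count n (p ∘ (false ∷_))

+-interchange : (a b c d : ℕ) → (a + b) + (c + d) ≡ (a + c) + (b + d)
+-interchange = CommutativeSemigroupProperties.interchange +-commutativeSemigroup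

count-cong : ∀ n {p q : Vect n → Bool} → (∀ v → p v ≡ q v) → count n p ≡ count n q
count-cong zero    p≗q = cong indicator (p≗q [])
count-cong (suc n) p≗q =
  cong₂ _+_ (count-cong n (p≗q ∘ (true ∷_))) (count-cong n (p≗q ∘ (false ∷_)))

count-∨+∧ : ∀ n (p q : Vect n → Bool) →
  count n (λ v → p v ∨ q v) + count n (λ v → p v ∧ q v) ≡ count n p + count n q
count-∨+∧ zero p q = base (p []) (q [])
  where
  base : ∀ a b → indicator (a ∨ b) + indicator (a ∧ b) ≡ indicator a + indicator b
  base true  true  = refl
  base true  false = refl
  base false true  = refl
  base false false = refl
count-∨+∧ (suc n) p q =
  trans (+-interchange (#ᵗ (λ v → p v ∨ q v)) (#ᶠ (λ v → p v ∨ q v))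
                       (#ᵗ (λ v → p v ∧ q v)) (#ᶠ (λ v → p v ∧ q v)))
    (trans (cong₂ _+_ (count-∨+∧ n (p ∘ (true ∷_)) (q ∘ (true ∷_)))
                      (count-∨+∧ n (p ∘ (false ∷_)) (q ∘ (false ∷_))))
           (+-interchange (#ᵗ p) (#ᵗ q) (#ᶠ p) (#ᶠ q)))
  where
  #ᵗ #ᶠ : (Vect (suc n) → Bool) → ℕ
  #ᵗ r = count n (r ∘ (true ∷_))
  #ᶠ r = count n (r ∘ (false ∷_))

count-split : ∀ n (p q : Vect n → Bool) →
  count n p ≡ count n (λ v → p v ∧ q v) + count n (λ v → p v ∧ not (q v))
count-split zero p q = base (p []) (q [])
  where
  base : ∀ a b → indicator a ≡ indicator (a ∧ b) + indicator (a ∧ not b)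
  base true  true  = refl
  base true  false = refl
  base false b     = refl
count-split (suc n) p q =
  trans (cong₂ _+_ (count-split n (p ∘ (true ∷_)) (q ∘ (true ∷_)))
                   (count-split n (p ∘ (false ∷_)) (q ∘ (false ∷_))))
        (+-interchange (#ᵗ (λ v → p v ∧ q v)) (#ᵗ (λ v → p v ∧ not (q v)))
                       (#ᶠ (λ v → p v ∧ q v)) (#ᶠ (λ v → p v ∧ not (q v))))
  where
  #ᵗ #ᶠ : (Vect (suc n) → Bool) → ℕ
  #ᵗ r = count n (r ∘ (true ∷_))
  #ᶠ r = count n (r ∘ (false ∷_))

count-mono : ∀ n {p q : Vect n → Bool} → (∀ v → p v ≡ true → q v ≡ true) →
  count n p ≤ count n q
count-mono zero {p} p⇒q with p [] in e
... | true  = subst (λ b → 1 ≤ indicator b) (sym (p⇒q [] e)) ≤-refl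
... | false = z≤n
count-mono (suc n) p⇒q =
  +-mono-≤ (count-mono n (p⇒q ∘ (true ∷_))) (count-mono n (p⇒q ∘ (false ∷_)))

count-true : ∀ n → count n (λ _ → true) ≡ 2 ^ n
count-true zero    = refl
count-true (suc n) = cong₂ _+_ (count-true n) (trans (count-true n) (sym (+-identityʳ _)))

count-≤ : ∀ n (p : Vect n → Bool) → count n p ≤ 2 ^ n
count-≤ n p = subst (count n p ≤_) (count-true n) (count-mono n (λ _ _ → refl))

count-false : ∀ n (p : Vect n → Bool) → (∀ v → p v ≡ false) → count n p ≡ 0
count-false zero    p p≡false rewrite p≡false [] = refl
count-false (suc n) p p≡false =
  cong₂ _+_ (count-false n _ (p≡false ∘ (true ∷_))) (count-false n _ (p≡false ∘ (false ∷_)))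

count≡0⇒false : ∀ n (p : Vect n → Bool) → count n p ≡ 0 → ∀ v → p v ≡ false
count≡0⇒false zero p c≡0 [] with p []
... | false = refl
count≡0⇒false (suc n) p c≡0 (true ∷ v) = count≡0⇒false n _ (m+n≡0⇒m≡0 _ c≡0) v
count≡0⇒false (suc n) p c≡0 (false ∷ v) = count≡0⇒false n _ (m+n≡0⇒n≡0 _ c≡0) v

count-≥1 : ∀ n (p : Vect n → Bool) v → p v ≡ true → 1 ≤ count n p
count-≥1 zero    p []          e rewrite e = ≤-refl
count-≥1 (suc n) p (true ∷ v)  e = ≤-trans (count-≥1 n _ v e) (m≤m+n _ _)
count-≥1 (suc n) p (false ∷ v) e = ≤-trans (count-≥1 n _ v e) (m≤n+m _ _)

count-≥2 : ∀ n (p : Vect n → Bool) u v → p u ≡ true → p v ≡ true → u ≢ v → 2 ≤ count n p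
count-≥2 zero p [] [] _ _ u≢v = contradiction refl u≢v
count-≥2 (suc n) p (true ∷ u) (true ∷ v) pu pv u≢v =
  ≤-trans (count-≥2 n _ u v pu pv (u≢v ∘ cong (true ∷_))) (m≤m+n _ _)
count-≥2 (suc n) p (false ∷ u) (false ∷ v) pu pv u≢v =
  ≤-trans (count-≥2 n _ u v pu pv (u≢v ∘ cong (false ∷_))) (m≤n+m _ _)
count-≥2 (suc n) p (true ∷ u) (false ∷ v) pu pv _ = +-mono-≤ (count-≥1 n _ u pu) (count-≥1 n _ v pv)
count-≥2 (suc n) p (false ∷ u) (true ∷ v) pu pv _ = +-mono-≤ (count-≥1 n _ v pv) (count-≥1 n _ u pu)

count-isZero : ∀ n → count n isZero ≡ 1
count-isZero zero    = refl
count-isZero (suc n) = cong₂ _+_ (count-false n _ (λ _ → refl)) (count-isZero n)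

count-translate : ∀ n (a : Vect n) (p : Vect n → Bool) → count n (p ∘ (a ⊕_)) ≡ count n p
count-translate zero    []          p = refl
count-translate (suc n) (false ∷ a) p =
  cong₂ _+_ (count-translate n a (p ∘ (true ∷_))) (count-translate n a (p ∘ (false ∷_)))
count-translate (suc n) (true ∷ a)  p =
  trans (cong₂ _+_ (count-translate n a (p ∘ (false ∷_))) (count-translate n a (p ∘ (true ∷_))))
        (+-comm (count n (p ∘ (false ∷_))) (count n (p ∘ (true ∷_))))

search : ∀ n (p : Vect n → Bool) → (∃[ v ] p v ≡ true) ⊎ (∀ v → p v ≡ false)
search zero p with p [] in e
... | true  = inj₁ ([] , e)
... | false = inj₂ λ { [] → e }
search (suc n) p with search n (p ∘ (true ∷_)) | search n (p ∘ (false ∷_))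
... | inj₁ (v , e) | _            = inj₁ (true ∷ v , e)
... | inj₂ _       | inj₁ (v , e) = inj₁ (false ∷ v , e)
... | inj₂ h₁      | inj₂ h₀      = inj₂ λ { (true ∷ v) → h₁ v ; (false ∷ v) → h₀ v }

count-∧≥⇒⊆ : ∀ n (p q : Vect n → Bool) → count n p ≤ count n (λ v → p v ∧ q v) →
  ∀ v → p v ≡ true → q v ≡ true
count-∧≥⇒⊆ n p q p≤p∧q v pv with q v in qv
... | true  = refl
... | false = case trans (sym (cong₂ (λ a b → a ∧ not b) pv qv))
                        (count≡0⇒false n p∧¬q count-p∧¬q≡0 v) of λ ()
  where
  p∧q p∧¬q : Vect n → Bool
  p∧q  v = p v ∧ q v
  p∧¬q v = p v ∧ not (q v)
  count-p∧¬q≡0 : count n p∧¬q ≡ 0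
  count-p∧¬q≡0 = n≤0⇒n≡0 (+-cancelˡ-≤ (count n p∧q) _ 0 (begin
    count n p∧q + count n p∧¬q ≡⟨ count-split n p q ⟨
    count n p                  ≤⟨ p≤p∧q ⟩
    count n p∧q                ≡⟨ +-identityʳ _ ⟨
    count n p∧q + 0            ∎))
    where open ≤-Reasoning

-- Spans and dimension

lincomb-false : ∀ k (b : Fin k → Vect n) → lincomb k (λ _ → false) b ≡ 𝟎
lincomb-false zero    b = refl
lincomb-false (suc k) b = trans (⊕-identityˡ _) (lincomb-false k (tail b))

lincomb-xor : ∀ k (s t : Fin k → Bool) (b : Fin k → Vect n) →
  lincomb k s b ⊕ lincomb k t b ≡ lincomb k (λ i → s i xor t i) b
lincomb-xor zero    s t b = ⊕-self 𝟎
lincomb-xor (suc k) s t b =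
  trans (⊕-interchange (scale (s zero)) (lincomb k (tail s) (tail b))
                       (scale (t zero)) (lincomb k (tail t) (tail b)))
        (cong₂ _⊕_ (scale-xor (s zero) (t zero)) (lincomb-xor k (tail s) (tail t) (tail b)))
  where
  scale : Bool → Vect _
  scale c = if c then b zero else 𝟎
  scale-xor : ∀ c d → scale c ⊕ scale d ≡ scale (c xor d)
  scale-xor true  true  = ⊕-self (b zero)
  scale-xor true  false = ⊕-identityʳ (b zero)
  scale-xor false d     = ⊕-identityˡ (scale d)

lincomb-∈ : (U : Subspace n) → ∀ k (s : Fin k → Bool) (b : Fin k → Vect n) →
  (∀ i → b i ∈S U) → lincomb k s b ∈S U
lincomb-∈ U zero    s b _   = mem-zero U
lincomb-∈ U (suc k) s b b∈U =
  mem-add U _ _ head∈U (lincomb-∈ U k (tail s) (tail b) (b∈U ∘ suc))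
  where
  head∈U : (if s zero then b zero else 𝟎) ∈S U
  head∈U with s zero
  ... | true  = b∈U zero
  ... | false = mem-zero U

-- B +⟨ b ⟩ is the set B + span b.
_+⟨_⟩ : (Vect n → Bool) → (Fin k → Vect n) → Vect n → Bool
_+⟨_⟩ {k = zero}  B b v = B v
_+⟨_⟩ {k = suc k} B b v = (B +⟨ tail b ⟩) v ∨ (B +⟨ tail b ⟩) (b zero ⊕ v)

+⟨⟩-sound : ∀ k (B : Vect n → Bool) (b : Fin k → Vect n) v →
  (B +⟨ b ⟩) v ≡ true → ∃[ s ] B (lincomb k s b ⊕ v) ≡ true
+⟨⟩-sound zero B b v v∈ = (λ ()) , subst (λ w → B w ≡ true) (sym (⊕-identityˡ v)) v∈
+⟨⟩-sound (suc k) B b v v∈ with ∨-elim _ _ v∈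
... | inj₁ v∈′ =
  let s , e = +⟨⟩-sound k B (tail b) v v∈′
  in (false ◂ s) , subst (λ w → B (w ⊕ v) ≡ true) (sym (⊕-identityˡ _)) e
... | inj₂ b₀⊕v∈′ =
  let s , e = +⟨⟩-sound k B (tail b) (b zero ⊕ v) b₀⊕v∈′
  in (true ◂ s) , subst (λ w → B w ≡ true) (sym (⊕-xy∙z≡y∙xz (b zero) _ v)) e

+⟨⟩-complete : ∀ k (B : Vect n → Bool) (b : Fin k → Vect n) v (s : Fin k → Bool) →
  B (lincomb k s b ⊕ v) ≡ true → (B +⟨ b ⟩) v ≡ true
+⟨⟩-complete zero B b v s e = subst (λ w → B w ≡ true) (⊕-identityˡ v) e
+⟨⟩-complete (suc k) B b v s e with s zero
... | true  = ∨-introʳ _ (+⟨⟩-complete k B (tail b) (b zero ⊕ v) (tail s)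
                (subst (λ w → B w ≡ true) (⊕-xy∙z≡y∙xz (b zero) _ v) e))
... | false = ∨-introˡ _ (+⟨⟩-complete k B (tail b) v (tail s)
                (subst (λ w → B (w ⊕ v) ≡ true) (⊕-identityˡ _) e))

+⟨⟩-base : ∀ k (B : Vect n → Bool) (b : Fin k → Vect n) v → B v ≡ true → (B +⟨ b ⟩) v ≡ true
+⟨⟩-base k B b v Bv = +⟨⟩-complete k B b v (λ _ → false)
  (subst (λ w → B (w ⊕ v) ≡ true) (sym (lincomb-false k b))
    (subst (λ w → B w ≡ true) (sym (⊕-identityˡ v)) Bv))

+⟨⟩-closed : ∀ k (B : Vect n → Bool) (b : Fin k → Vect n) → Closed B → Closed (B +⟨ b ⟩)
+⟨⟩-closed k B b B-closed u v u∈ v∈ with +⟨⟩-sound k B b u u∈ | +⟨⟩-sound k B b v v∈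
... | s , Bsu | t , Btv = +⟨⟩-complete k B b (u ⊕ v) (λ i → s i xor t i)
  (subst (λ w → B w ≡ true)
         (trans (⊕-interchange (lincomb k s b) u (lincomb k t b) v)
                (cong (_⊕ (u ⊕ v)) (lincomb-xor k s t b)))
         (B-closed _ _ Bsu Btv))

IndependentOver : (Vect n → Bool) → (Fin k → Vect n) → Set
IndependentOver {k = k} B b = ∀ s → B (lincomb k s b) ≡ true → ∀ i → s i ≡ false

IndependentOver-tail : (B : Vect n → Bool) (b : Fin (suc k) → Vect n) →
  IndependentOver B b → IndependentOver B (tail b)
IndependentOver-tail B b indep s Bs i =
  indep (false ◂ s) (subst (λ w → B w ≡ true) (sym (⊕-identityˡ _)) Bs) (suc i)

-- Independence over B makes the 2ᵏ translates of B by span b pairwise disjoint.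
count-+⟨⟩ : ∀ k (B : Vect n → Bool) (b : Fin k → Vect n) → Closed B → IndependentOver B b →
  count n (B +⟨ b ⟩) ≡ 2 ^ k * count n B
count-+⟨⟩ zero B b _ _ = sym (+-identityʳ _)
count-+⟨⟩ {n} (suc k) B b B-closed indep = begin
  count n A∪A′                   ≡⟨ +-identityʳ _ ⟨
  count n A∪A′ + 0               ≡⟨ cong (count n A∪A′ +_) (count-false n A∩A′ disjoint) ⟨
  count n A∪A′ + count n A∩A′    ≡⟨ count-∨+∧ n A A′ ⟩
  count n A + count n A′         ≡⟨ cong (count n A +_) (count-translate n (b zero) A) ⟩
  count n A + count n A          ≡⟨ cong₂ _+_ IH (trans IH (sym (+-identityʳ _))) ⟩
  2 * (2 ^ k * count n B)        ≡⟨ *-assoc 2 (2 ^ k) _ ⟨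
  2 ^ suc k * count n B          ∎
  where
  open ≡-Reasoning
  A A′ A∪A′ A∩A′ : Vect n → Bool
  A      = B +⟨ tail b ⟩
  A′ v   = A (b zero ⊕ v)
  A∪A′ v = A v ∨ A′ v
  A∩A′ v = A v ∧ A′ v
  IH : count n A ≡ 2 ^ k * count n B
  IH = count-+⟨⟩ k B (tail b) B-closed (IndependentOver-tail B b indep)
  b₀∉A : A (b zero) ≡ true → ⊥
  b₀∉A b₀∈A with +⟨⟩-sound k B (tail b) (b zero) b₀∈A
  ... | s , e = case indep (true ◂ s) (subst (λ w → B w ≡ true) (⊕-comm _ (b zero)) e) zero of λ ()
  disjoint : ∀ v → A∩A′ v ≡ false
  disjoint v with A v in Av | A′ v in A′v
  ... | false | _     = refl
  ... | true  | false = refl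
  ... | true  | true  = ⊥-elim (b₀∉A (subst (λ w → A w ≡ true) (⊕-cancelˡ v (b zero))
                          (+⟨⟩-closed k B (tail b) B-closed v (b zero ⊕ v) Av A′v)))

span : (Fin k → Vect n) → Subspace n
mem      (span {k} b) = isZero +⟨ b ⟩
mem-zero (span {k} {n} b) = +⟨⟩-base k isZero b 𝟎 (isZero-𝟎 {n})
mem-add  (span {k} b) = +⟨⟩-closed k isZero b isZero-closed

∈span⇔ : ∀ k (b : Fin k → Vect n) v → v ∈S span b ⇔ (∃[ s ] lincomb k s b ≡ v)
∈span⇔ k b v = mk⇔
  (λ v∈ → let s , e = +⟨⟩-sound k isZero b v v∈ in s , ⊕≡𝟎⇒≡ _ v (isZero⇒≡𝟎 _ e))
  (λ { (s , refl) → +⟨⟩-complete k isZero b _ s (isZero-⊕-self (lincomb k s b)) })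

span-dim : ∀ k (b : Fin k → Vect n) → LinIndep b → HasDim (span b) k
span-dim k b indep = b , indep , ∈span⇔ k b

≈S-from-⇔ : (U W : Subspace n) → (∀ v → v ∈S U ⇔ v ∈S W) → U ≈S W
≈S-from-⇔ U W U⇔W v = ⇔→≡ (U⇔W v)

HasDim-cong : {U W : Subspace n} → U ≈S W → HasDim U k → HasDim W k
HasDim-cong U≈W (b , indep , U⇔span) = b , indep , λ v → mk⇔
  (λ v∈W → Equivalence.to (U⇔span v) (trans (U≈W v) v∈W))
  (λ v∈span → trans (sym (U≈W v)) (Equivalence.from (U⇔span v) v∈span))

size : Subspace n → ℕ
size {n} U = count n (mem U)

size-cong : {U W : Subspace n} → U ≈S W → size U ≡ size W
size-cong {n} U≈W = count-cong n U≈W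

HasDim⇒size : (U : Subspace n) → HasDim U k → size U ≡ 2 ^ k
HasDim⇒size {n} {k} U (b , indep , U⇔span) = begin
  size U                      ≡⟨ size-cong {U = U} {W = span b} U≈span ⟩
  count n (isZero +⟨ b ⟩)     ≡⟨ count-+⟨⟩ k isZero b isZero-closed
                                   (λ s z → indep s (isZero⇒≡𝟎 _ z)) ⟩
  2 ^ k * count n isZero      ≡⟨ cong (2 ^ k *_) (count-isZero n) ⟩
  2 ^ k * 1                   ≡⟨ *-identityʳ _ ⟩
  2 ^ k                       ∎
  where
  open ≡-Reasoning
  U≈span : U ≈S span b
  U≈span = ≈S-from-⇔ U (span b) λ v → mk⇔
    (λ v∈U → Equivalence.from (∈span⇔ k b v) (Equivalence.to (U⇔span v) v∈U))
    (λ v∈span → Equivalence.from (U⇔span v) (Equivalence.to (∈span⇔ k b v) v∈span))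

2^-cancel-≤ : ∀ a b → 2 ^ a ≤ 2 ^ b → a ≤ b
2^-cancel-≤ a b 2^a≤2^b with a ≤? b
... | yes a≤b = a≤b
... | no  a≰b = contradiction 2^a≤2^b (<⇒≱ (^-monoʳ-< 2 (s≤s (s≤s z≤n)) (≰⇒> a≰b)))

HasDim-unique : (U : Subspace n) → ∀ {a b} → HasDim U a → HasDim U b → a ≡ b
HasDim-unique U {a} {b} dimA dimB = ≤-antisym
  (2^-cancel-≤ a b (≤-reflexive 2^a≡2^b)) (2^-cancel-≤ b a (≤-reflexive (sym 2^a≡2^b)))
  where
  2^a≡2^b : 2 ^ a ≡ 2 ^ b
  2^a≡2^b = trans (sym (HasDim⇒size U dimA)) (HasDim⇒size U dimB)

LinIndep⇒≤ : (b : Fin k → Vect n) → LinIndep b → k ≤ n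
LinIndep⇒≤ {k} {n} b indep = 2^-cancel-≤ k n
  (subst (_≤ 2 ^ n) (HasDim⇒size (span b) (span-dim k b indep)) (count-≤ n _))

LinIndep-◂ : (b : Fin k → Vect n) → LinIndep b → ∀ v → mem (span b) v ≡ false → LinIndep (v ◂ b)
LinIndep-◂ {k} b indep v v∉span s s·b≡𝟎 i with s zero in s₀
... | true  = case trans (sym v∉span) (Equivalence.from (∈span⇔ k b v)
                (tail s , sym (⊕≡𝟎⇒≡ v _ s·b≡𝟎))) of λ ()
LinIndep-◂ b indep v v∉span s s·b≡𝟎 zero    | false = s₀
LinIndep-◂ b indep v v∉span s s·b≡𝟎 (suc i) | false =
  indep (tail s) (trans (sym (⊕-identityˡ _)) s·b≡𝟎) i

dimension : (U : Subspace n) → ∃ (HasDim U)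
dimension {n} U = extend (suc n) {0} (λ ()) (λ _ _ ()) (λ ()) (n<1+n n)
  where
  -- Fuel cannot run out, as independent families in F₂ⁿ have at most n members.
  extend : ∀ fuel {k} (b : Fin k → Vect n) → LinIndep b → (∀ i → b i ∈S U) →
           n < k + fuel → ∃ (HasDim U)
  extend zero {k} b indep b∈U n<k+0 =
    contradiction (LinIndep⇒≤ b indep) (<⇒≱ (subst (n <_) (+-identityʳ k) n<k+0))
  extend (suc fuel) {k} b indep b∈U n<k+fuel
    with search n (λ v → mem U v ∧ not (mem (span b) v))
  ... | inj₁ (v , e) =
    extend fuel (v ◂ b) (LinIndep-◂ b indep v (not-true⇒false (proj₂ (∧-true e))))
      (λ { zero → proj₁ (∧-true e) ; (suc i) → b∈U i })
      (subst (n <_) (+-suc k fuel) n<k+fuel)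
  ... | inj₂ U⊆span = k , HasDim-cong {U = span b} {W = U} span≈U (span-dim k b indep)
    where
    span≈U : span b ≈S U
    span≈U = ≈S-from-⇔ (span b) U λ v → mk⇔
      (λ v∈span → let s , e = Equivalence.to (∈span⇔ k b v) v∈span
                  in subst (_∈S U) e (lincomb-∈ U k s b b∈U))
      (λ v∈U → not-false⇒true
        (trans (cong (λ x → x ∧ not (mem (span b) v)) (sym v∈U)) (U⊆span v)))

-- Subspace distance

≈S-sym : {U W : Subspace n} → U ≈S W → W ≈S U
≈S-sym U≈W v = sym (U≈W v)

≈S-trans : {U W X : Subspace n} → U ≈S W → W ≈S X → U ≈S X
≈S-trans U≈W W≈X v = trans (U≈W v) (W≈X v)

≈S-setoid : ℕ → Setoid _ _
≈S-setoid n = record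
  { Carrier       = Subspace n
  ; _≈_           = _≈S_
  ; isEquivalence = record
    { refl  = λ _ → refl
    ; sym   = λ {U} {W} → ≈S-sym {U = U} {W = W}
    ; trans = λ {U} {W} {X} → ≈S-trans {U = U} {W = W} {X = X}
    }
  }

∩S-comm : (U W : Subspace n) → (U ∩S W) ≈S (W ∩S U)
∩S-comm U W v = ∧-comm (mem U v) (mem W v)

size-≤1⇒trivial : (U : Subspace n) → size U ≤ 1 → ∀ v → v ∈S U → v ≡ 𝟎
size-≤1⇒trivial {n} U size≤1 v v∈U with ≡-dec _≟ᴮ_ v 𝟎
... | yes v≡𝟎 = v≡𝟎
... | no  v≢𝟎 =
  contradiction (count-≥2 n (mem U) v 𝟎 v∈U (mem-zero U) v≢𝟎) (<⇒≱ (s≤s size≤1))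

trivial⇒size-≤1 : (U : Subspace n) → (∀ v → v ∈S U → v ≡ 𝟎) → size U ≤ 1
trivial⇒size-≤1 {n} U trivial = subst (size U ≤_) (count-isZero n) (count-mono n λ v v∈U →
  subst (λ w → isZero w ≡ true) (sym (trivial v v∈U)) (isZero-𝟎 {n}))

size-∩-≥2 : (U W : Subspace n) → ∀ {a b} → HasDim U a → HasDim W b → n < a + b →
  2 ≤ size (U ∩S W)
size-∩-≥2 {n} U W {a} {b} dimU (w , w-indep , W⇔span) n<a+b
  with search n (λ v → (mem U v ∧ mem W v) ∧ not (isZero v))
... | inj₁ (v , e) =
  count-≥2 n (mem (U ∩S W)) v 𝟎 (proj₁ (∧-true e)) (true-∧ (mem-zero U) (mem-zero W)) v≢𝟎
  where
  v≢𝟎 : v ≢ 𝟎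
  v≢𝟎 refl = case trans (sym (proj₂ (∧-true e))) (cong not (isZero-𝟎 {n})) of λ ()
... | inj₂ U∩W-trivial = contradiction (count-≤ n (mem U +⟨ w ⟩)) (<⇒≱ too-big)
  where
  indep : IndependentOver (mem U) w
  indep s s·w∈U = w-indep s (isZero⇒≡𝟎 _ (not-false⇒true
    (trans (cong (λ x → x ∧ not (isZero (lincomb b s w))) (sym (true-∧ s·w∈U s·w∈W)))
           (U∩W-trivial _))))
    where
    s·w∈W : lincomb b s w ∈S W
    s·w∈W = Equivalence.from (W⇔span _) (s , refl)
  too-big : 2 ^ n < count n (mem U +⟨ w ⟩)
  too-big = begin-strict
    2 ^ n                  <⟨ ^-monoʳ-< 2 (s≤s (s≤s z≤n)) n<a+b ⟩
    2 ^ (a + b)            ≡⟨ ^-distribˡ-+-* 2 a b ⟩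
    2 ^ a * 2 ^ b          ≡⟨ *-comm (2 ^ a) (2 ^ b) ⟩
    2 ^ b * 2 ^ a          ≡⟨ cong (2 ^ b *_) (HasDim⇒size U dimU) ⟨
    2 ^ b * size U         ≡⟨ count-+⟨⟩ b (mem U) w (mem-add U) indep ⟨
    count n (mem U +⟨ w ⟩) ∎
    where open ≤-Reasoning

DistAtLeast⇒size-∩-≤ : ∀ {d a b c} (U W : Subspace n) → DistAtLeast d U W →
  HasDim U a → HasDim W b → a + b < d + 2 * suc c → size (U ∩S W) ≤ 2 ^ c
DistAtLeast⇒size-∩-≤ {d = d} {a} {b} {c} U W dist dimU dimW a+b<d+2[1+c]
  with dimension (U ∩S W)
... | c′ , dimU∩W =
  subst (_≤ 2 ^ c) (sym (HasDim⇒size (U ∩S W) dimU∩W)) (^-monoʳ-≤ 2 (≤-pred c′<1+c))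
  where
  c′<1+c : c′ < suc c
  c′<1+c = *-cancelˡ-< 2 c′ (suc c)
    (+-cancelˡ-< d _ _ (≤-<-trans (dist a b c′ dimU dimW dimU∩W) a+b<d+2[1+c]))

size-∩⇒DistAtLeast : ∀ {d a b c} (U W : Subspace n) → HasDim U a → HasDim W b →
  size (U ∩S W) ≤ 2 ^ c → d + 2 * c ≤ a + b → DistAtLeast d U W
size-∩⇒DistAtLeast {d = d} {c = c} U W dimU dimW small d+2c≤a+b a′ b′ c′ dimU′ dimW′ dimU∩W′
  rewrite HasDim-unique U dimU′ dimU | HasDim-unique W dimW′ dimW =
    ≤-trans (+-monoʳ-≤ d (*-monoʳ-≤ 2 c′≤c)) d+2c≤a+b
  where
  c′≤c : c′ ≤ c
  c′≤c = 2^-cancel-≤ c′ c (subst (_≤ 2 ^ c) (HasDim⇒size (U ∩S W) dimU∩W′) small)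

DistAtLeast-cong : ∀ {d} (U U′ W W′ : Subspace n) → U ≈S U′ → W ≈S W′ →
  DistAtLeast d U W → DistAtLeast d U′ W′
DistAtLeast-cong U U′ W W′ U≈U′ W≈W′ dist a b c dimU′ dimW′ dimU′∩W′ =
  dist a b c (HasDim-cong {U = U′} {W = U} (≈S-sym {U = U} {W = U′} U≈U′) dimU′)
             (HasDim-cong {U = W′} {W = W} (≈S-sym {U = W} {W = W′} W≈W′) dimW′)
             (HasDim-cong {U = U′ ∩S W′} {W = U ∩S W}
               (λ v → sym (cong₂ _∧_ (U≈U′ v) (W≈W′ v))) dimU′∩W′)

-- Two listings of the same subspaces

module _ {a ℓ} (𝒮 : Setoid a ℓ) where
  open Setoid 𝒮 using (Carrier; _≈_) renaming (refl to ≈-refl; sym to ≈-sym)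
  open import Relation.Binary.Reasoning.Setoid 𝒮

  covers-injective⇒injective : (C T : Fin m → Carrier) → (∀ k k′ → T k ≈ T k′ → k ≡ k′) →
    (∀ k → ∃[ i ] C i ≈ T k) → ∀ i i′ → C i ≈ C i′ → i ≡ i′
  covers-injective⇒injective {suc m} C T T-injective covers i i′ Ci≈Ci′ with i ≟ i′
  ... | yes i≡i′ = i≡i′
  ... | no  i≢i′ = contradiction (injective⇒≤ f-injective) 1+n≰n
    where
    -- Identifying i′ with i leaves m indices, yet T injects into them.
    merge : Fin (suc m) → Fin (suc m)
    merge x with x ≟ i′
    ... | yes _ = i
    ... | no  _ = x
    i′≢merge : ∀ x → i′ ≢ merge x
    i′≢merge x with x ≟ i′
    ... | yes _    = i≢i′ ∘ sym
    ... | no x≢i′ = x≢i′ ∘ sym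
    C-merge : ∀ x → C (merge x) ≈ C x
    C-merge x with x ≟ i′
    ... | yes refl = Ci≈Ci′
    ... | no  _    = ≈-refl
    preimage : Fin (suc m) → Fin (suc m)
    preimage k = proj₁ (covers k)
    f : Fin (suc m) → Fin m
    f k = punchOut (i′≢merge (preimage k))
    f-injective : ∀ {k k′} → f k ≡ f k′ → k ≡ k′
    f-injective {k} {k′} fk≡fk′ = T-injective k k′ (begin
      T k                       ≈⟨ ≈-sym (proj₂ (covers k)) ⟩
      C (preimage k)            ≈⟨ ≈-sym (C-merge (preimage k)) ⟩
      C (merge (preimage k))    ≡⟨ cong C (punchOut-injective (i′≢merge (preimage k))
                                                              (i′≢merge (preimage k′)) fk≡fk′) ⟩
      C (merge (preimage k′))   ≈⟨ C-merge (preimage k′) ⟩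
      C (preimage k′)           ≈⟨ proj₂ (covers k′) ⟩
      T k′                      ∎)

Relabelling : (C T : Fin m → Subspace n) → Set
Relabelling C T = (∀ i → ∃[ k ] C i ≈S T k) × (∀ k → ∃[ i ] C i ≈S T k)

SameSet⇒Relabelling : (C : Fin (suc m) → Subspace n) (S : Fin m → Subspace n) (F : Subspace n) →
  SameSet C S F → Relabelling C (F ◂ S)
SameSet⇒Relabelling C S F same = to , from
  where
  to : ∀ i → ∃[ k ] C i ≈S (F ◂ S) k
  to i with Equivalence.to (same (C i)) (i , λ _ → refl)
  ... | inj₁ (k , Sk≈Ci) = suc k , ≈S-sym {U = S k} {W = C i} Sk≈Ci
  ... | inj₂ F≈Ci        = zero , ≈S-sym {U = F} {W = C i} F≈Ci
  from : ∀ k → ∃[ i ] C i ≈S (F ◂ S) k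
  from zero    = Equivalence.from (same F) (inj₂ (λ _ → refl))
  from (suc k) = Equivalence.from (same (S k)) (inj₁ (k , λ _ → refl))

SameSet-punchIn : (C : Fin (suc m) → Subspace n) (j : Fin (suc m)) → SameSet C (C ∘ punchIn j) (C j)
SameSet-punchIn C j U = mk⇔ to from
  where
  to : ∃[ i ] C i ≈S U → (∃[ k ] C (punchIn j k) ≈S U) ⊎ C j ≈S U
  to (i , Ci≈U) with j ≟ i
  ... | yes refl = inj₂ Ci≈U
  ... | no  j≢i  = inj₁ (punchOut j≢i , subst (λ x → C x ≈S U) (sym (punchIn-punchOut j≢i)) Ci≈U)
  from : (∃[ k ] C (punchIn j k) ≈S U) ⊎ C j ≈S U → ∃[ i ] C i ≈S U
  from (inj₁ (k , e)) = punchIn j k , e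
  from (inj₂ e)       = j , e

IsSubspaceCode-relabel : ∀ {d} (C T : Fin m → Subspace n) → Relabelling C T →
  IsSubspaceCode n m d T → IsSubspaceCode n m d C
IsSubspaceCode-relabel {n = n} {d = d} C T (to , from) (T-injective , T-dist) = C-injective , C-dist
  where
  C-injective : ∀ i i′ → C i ≈S C i′ → i ≡ i′
  C-injective = covers-injective⇒injective (≈S-setoid n) C T T-injective from
  C-dist : ∀ i i′ → i ≢ i′ → DistAtLeast d (C i) (C i′)
  C-dist i i′ i≢i′ with to i | to i′
  ... | k , Ci≈Tk | k′ , Ci′≈Tk′ =
    DistAtLeast-cong {d = d} (T k) (C i) (T k′) (C i′)
      (≈S-sym {U = C i} {W = T k} Ci≈Tk) (≈S-sym {U = C i′} {W = T k′} Ci′≈Tk′)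
      (T-dist k k′ k≢k′)
    where
    k≢k′ : k ≢ k′
    k≢k′ refl = i≢i′ (C-injective i i′
      (≈S-trans {U = C i} {W = T k} {X = C i′} Ci≈Tk (≈S-sym {U = C i′} {W = T k} Ci′≈Tk′)))

DimDist-relabel : (C T : Fin 17 → Subspace 7) → Relabelling C T →
  (∀ i i′ → C i ≈S C i′ → i ≡ i′) → DimDist3¹⁶5¹ T → DimDist3¹⁶5¹ C
DimDist-relabel C T (to , from) C-injective (j , dimTj , dimT) =
  i₀ , HasDim-cong {U = T j} {W = C i₀} (≈S-sym {U = C i₀} {W = T j} Ci₀≈Tj) dimTj , dimC
  where
  i₀ : Fin 17
  i₀ = proj₁ (from j)
  Ci₀≈Tj : C i₀ ≈S T j
  Ci₀≈Tj = proj₂ (from j)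
  dimC : ∀ i → i ≢ i₀ → HasDim (C i) 3
  dimC i i≢i₀ with to i
  ... | k , Ci≈Tk with k ≟ j
  ...   | yes refl = contradiction
            (C-injective i i₀ (≈S-trans {U = C i} {W = T k} {X = C i₀} Ci≈Tk
              (≈S-sym {U = C i₀} {W = T k} Ci₀≈Tj))) i≢i₀
  ...   | no  k≢j  = HasDim-cong {U = T k} {W = C i} (≈S-sym {U = C i} {W = T k} Ci≈Tk) (dimT k k≢j)

∑-mono-≤ : ∀ m {f g : Fin m → ℕ} → (∀ i → f i ≤ g i) → ∑[ i < m ] f i ≤ ∑[ i < m ] g i
∑-mono-≤ zero    _   = z≤n
∑-mono-≤ (suc m) f≤g = +-mono-≤ (f≤g zero) (∑-mono-≤ m (f≤g ∘ suc))

∑-const : ∀ m c → ∑[ i < m ] c ≡ m * c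
∑-const zero    c = refl
∑-const (suc m) c = cong (c +_) (∑-const m c)

∑-≤-* : ∀ m c (f : Fin m → ℕ) → (∀ i → f i ≤ c) → ∑[ i < m ] f i ≤ m * c
∑-≤-* m c f f≤c = subst (∑[ i < m ] f i ≤_) (∑-const m c) (∑-mono-≤ m f≤c)

∑-tight : ∀ m c (f : Fin m → ℕ) → (∀ i → c ≤ f i) → ∑[ i < m ] f i ≤ m * c →
  ∀ i → f i ≤ c
∑-tight (suc m) c f c≤f ∑f≤ zero = +-cancelʳ-≤ (m * c) (f zero) c (begin
  f zero + m * c                 ≤⟨ +-monoʳ-≤ (f zero) (subst (_≤ ∑[ i < m ] f (suc i)) (∑-const m c)
                                      (∑-mono-≤ m (c≤f ∘ suc))) ⟩
  f zero + ∑[ i < m ] f (suc i)  ≤⟨ ∑f≤ ⟩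
  c + m * c                      ∎)
  where open ≤-Reasoning
∑-tight (suc m) c f c≤f ∑f≤ (suc i) = ∑-tight m c (tail f) (c≤f ∘ suc)
  (+-cancelˡ-≤ c _ _ (≤-trans (+-monoˡ-≤ (∑[ i < m ] f (suc i)) (c≤f zero)) ∑f≤)) i

-- Vectors covered by a family of subspaces

covered : (Fin m → Subspace n) → Vect n → Bool
covered {m = zero}  S v = isZero v
covered {m = suc m} S v = mem (S zero) v ∨ covered (tail S) v

uncovered : (Fin m → Subspace n) → Vect n → Bool
uncovered S v = not (covered S v)

covered-𝟎 : (S : Fin m → Subspace n) → covered S 𝟎 ≡ true
covered-𝟎 {zero}  {n} S = isZero-𝟎 {n}
covered-𝟎 {suc m}     S = ∨-introˡ _ (mem-zero (S zero))

∈⇒covered : (S : Fin m → Subspace n) → ∀ i v → v ∈S S i → covered S v ≡ true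
∈⇒covered S zero    v v∈ = ∨-introˡ _ v∈
∈⇒covered S (suc i) v v∈ = ∨-introʳ _ (∈⇒covered (tail S) i v v∈)

covered⇒ : (S : Fin m → Subspace n) → ∀ v → covered S v ≡ true → v ≡ 𝟎 ⊎ ∃[ i ] v ∈S S i
covered⇒ {zero}  S v v∈ = inj₁ (isZero⇒≡𝟎 v v∈)
covered⇒ {suc m} S v v∈ with ∨-elim _ _ v∈
... | inj₁ v∈S₀ = inj₂ (zero , v∈S₀)
... | inj₂ v∈′ with covered⇒ (tail S) v v∈′
...   | inj₁ v≡𝟎      = inj₁ v≡𝟎
...   | inj₂ (i , v∈Sᵢ) = inj₂ (suc i , v∈Sᵢ)

uncovered⇒≢𝟎 : (S : Fin m → Subspace n) → ∀ v → uncovered S v ≡ true → v ≢ 𝟎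
uncovered⇒≢𝟎 S v unc refl = case trans (sym unc) (cong not (covered-𝟎 S)) of λ ()

uncovered⇒∉ : (S : Fin m → Subspace n) → ∀ v → uncovered S v ≡ true → ∀ i → ¬ v ∈S S i
uncovered⇒∉ S v unc i v∈ = case trans (sym unc) (cong not (∈⇒covered S i v v∈)) of λ ()

PairwiseTrivial : (Fin m → Subspace n) → Set
PairwiseTrivial S = ∀ i j → i ≢ j → ∀ v → v ∈S S i → v ∈S S j → v ≡ 𝟎

PairwiseTrivial-tail : (S : Fin (suc m) → Subspace n) → PairwiseTrivial S → PairwiseTrivial (tail S)
PairwiseTrivial-tail S trivial i j i≢j = trivial (suc i) (suc j) (i≢j ∘ Fin-suc-injective)

head∧covered-tail : (S : Fin (suc m) → Subspace n) → PairwiseTrivial S →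
  ∀ v → (mem (S zero) v ∧ covered (tail S) v) ≡ isZero v
head∧covered-tail {n = n} S trivial v = ⇔→≡ (mk⇔ to from)
  where
  to : (mem (S zero) v ∧ covered (tail S) v) ≡ true → isZero v ≡ true
  to both with covered⇒ (tail S) v (proj₂ (∧-true both))
  ... | inj₁ refl          = isZero-𝟎 {n}
  ... | inj₂ (i , v∈Sᵢ₊₁) = subst (λ w → isZero w ≡ true)
          (sym (trivial zero (suc i) (λ ()) v (proj₁ (∧-true both)) v∈Sᵢ₊₁)) (isZero-𝟎 {n})
  from : isZero v ≡ true → (mem (S zero) v ∧ covered (tail S) v) ≡ true
  from z rewrite isZero⇒≡𝟎 v z = true-∧ (mem-zero (S zero)) (covered-𝟎 (tail S))

∧-isZero : (P : Vect n → Bool) → P 𝟎 ≡ true → ∀ v → (P v ∧ isZero v) ≡ isZero v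
∧-isZero P P𝟎 v with isZero v in z
... | false = ∧-zeroʳ (P v)
... | true  = cong (_∧ true) (subst (λ w → P w ≡ true) (sym (isZero⇒≡𝟎 v z)) P𝟎)

∧-∧-distrib : ∀ p a b → ((p ∧ a) ∧ (p ∧ b)) ≡ (p ∧ (a ∧ b))
∧-∧-distrib true  a b = refl
∧-∧-distrib false a b = refl

count-∧-covered : ∀ m (S : Fin m → Subspace n) (P : Vect n → Bool) → PairwiseTrivial S →
  P 𝟎 ≡ true →
  count n (λ v → P v ∧ covered S v) + m ≡ 1 + ∑[ i < m ] count n (λ v → P v ∧ mem (S i) v)
count-∧-covered {n} zero S P _ P𝟎 =
  trans (+-identityʳ _) (trans (count-cong n (∧-isZero P P𝟎)) (count-isZero n))
count-∧-covered {n} (suc m) S P trivial P𝟎 = begin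
  X + suc m         ≡⟨ +-suc X m ⟩
  suc X + m         ≡⟨ cong (_+ m) (+-comm 1 X) ⟩
  (X + 1) + m       ≡⟨ cong (_+ m) head+tail ⟩
  (A + B) + m       ≡⟨ +-assoc A B m ⟩
  A + (B + m)       ≡⟨ cong (A +_) (count-∧-covered m (tail S) P (PairwiseTrivial-tail S trivial) P𝟎) ⟩
  A + suc Rest      ≡⟨ +-suc A Rest ⟩
  suc (A + Rest)    ∎
  where
  open ≡-Reasoning
  PA PB : Vect n → Bool
  PA v = P v ∧ mem (S zero) v
  PB v = P v ∧ covered (tail S) v
  X A B Rest : ℕ
  X = count n (λ v → P v ∧ covered S v)
  A = count n PA
  B = count n PB
  Rest = ∑[ i < m ] count n (λ v → P v ∧ mem (S (suc i)) v)
  PA∧PB≗isZero : ∀ v → (PA v ∧ PB v) ≡ isZero v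
  PA∧PB≗isZero v = trans (∧-∧-distrib (P v) _ _)
    (trans (cong (P v ∧_) (head∧covered-tail S trivial v)) (∧-isZero P P𝟎 v))
  head+tail : X + 1 ≡ A + B
  head+tail = begin
    X + 1                                                     ≡⟨ cong₂ _+_
      (count-cong n (λ v → ∧-distribˡ-∨ (P v) _ _))
      (sym (trans (count-cong n PA∧PB≗isZero) (count-isZero n))) ⟩
    count n (λ v → PA v ∨ PB v) + count n (λ v → PA v ∧ PB v) ≡⟨ count-∨+∧ n PA PB ⟩
    A + B                                                     ∎

-- The holes are exactly the lines through uncovered vectors.
holes-⊆⇔uncovered-⊆ : (S : Fin m → Subspace n) (F : Subspace n) →
  (∀ P → IsHole S P → P ⊆S F) ⇔ (∀ v → uncovered S v ≡ true → v ∈S F)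
holes-⊆⇔uncovered-⊆ S F = mk⇔ to from
  where
  to : (∀ P → IsHole S P → P ⊆S F) → ∀ v → uncovered S v ≡ true → v ∈S F
  to holes⊆F v unc = holes⊆F (span b) (span-dim 1 b b-indep , ¬⊆S) v v∈span
    where
    b : Fin 1 → Vect _
    b _ = v
    b-indep : LinIndep b
    b-indep s s·b≡𝟎 zero with s zero
    ... | false = refl
    ... | true  = contradiction (trans (sym (⊕-identityʳ v)) s·b≡𝟎) (uncovered⇒≢𝟎 S v unc)
    v∈span : v ∈S span b
    v∈span = Equivalence.from (∈span⇔ 1 b v) ((λ _ → true) , ⊕-identityʳ v)
    ¬⊆S : ∀ i → ¬ (span b ⊆S S i)
    ¬⊆S i span⊆Sᵢ = uncovered⇒∉ S v unc i (span⊆Sᵢ v v∈span)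
  from : (∀ v → uncovered S v ≡ true → v ∈S F) → ∀ P → IsHole S P → P ⊆S F
  from unc⊆F P ((b , b-indep , P⇔span) , ¬⊆S) w w∈P with Equivalence.to (P⇔span w) w∈P
  ... | s , refl = lincomb-∈ F 1 s b λ { zero → unc⊆F (b zero) b₀-uncovered }
    where
    P⊆ : ∀ i → b zero ∈S S i → P ⊆S S i
    P⊆ i b₀∈Sᵢ u u∈P with Equivalence.to (P⇔span u) u∈P
    ... | t , refl = lincomb-∈ (S i) 1 t b λ { zero → b₀∈Sᵢ }
    b₀-uncovered : uncovered S (b zero) ≡ true
    b₀-uncovered with covered S (b zero) in c
    ... | false = refl
    ... | true with covered⇒ S (b zero) c
    ...   | inj₁ b₀≡𝟎 =
      case b-indep (λ _ → true) (trans (⊕-identityʳ (b zero)) b₀≡𝟎) zero of λ ()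
    ...   | inj₂ (i , b₀∈Sᵢ) = contradiction (P⊆ i b₀∈Sᵢ) (¬⊆S i)

-- Sixteen planes and a 5-space in F₂⁷

module PlaneSpread (S : Fin 16 → Subspace 7) (spread : IsPartialPlaneSpread 16 S) where

  private
    dimS : ∀ i → HasDim (S i) 3
    dimS = proj₁ spread
    trivial : PairwiseTrivial S
    trivial = proj₂ (proj₂ spread)

  count-covered : count 7 (covered S) ≡ 113
  count-covered = +-cancelʳ-≡ 16 (count 7 (covered S)) 113 (begin
    count 7 (covered S) + 16  ≡⟨ count-∧-covered 16 S (λ _ → true) trivial refl ⟩
    1 + ∑[ i < 16 ] size (S i) ≡⟨ cong suc (sum-cong-≗ (λ i → HasDim⇒size (S i) (dimS i))) ⟩
    113 + 16                  ∎)
    where open ≡-Reasoning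

  count-uncovered : count 7 (uncovered S) ≡ 15
  count-uncovered = +-cancelˡ-≡ 113 (count 7 (uncovered S)) 15
    (trans (cong (_+ count 7 (uncovered S)) (sym count-covered)) covered+uncovered)
    where
    covered+uncovered : count 7 (covered S) + count 7 (uncovered S) ≡ 128
    covered+uncovered = trans (sym (count-split 7 (λ _ → true) (covered S))) (count-true 7)

  module _ (F : Subspace 7) (dimF : HasDim F 5) where

    private
      F∩covered F∩uncovered : ℕ
      F∩covered   = count 7 (λ v → mem F v ∧ covered S v)
      F∩uncovered = count 7 (λ v → mem F v ∧ uncovered S v)

      F∩planes : Fin 16 → ℕ
      F∩planes i = size (F ∩S S i)

      F∩covered-∑ : F∩covered + 16 ≡ 1 + ∑[ i < 16 ] F∩planes i
      F∩covered-∑ = count-∧-covered 16 S (mem F) trivial (mem-zero F)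

      F-split : F∩covered + F∩uncovered ≡ 32
      F-split = trans (sym (count-split 7 (mem F) (covered S))) (HasDim⇒size F dimF)

      F-meets-planes : ∀ i → 2 ≤ F∩planes i
      F-meets-planes i = size-∩-≥2 F (S i) dimF (dimS i) ≤-refl

    uncovered-⊆⇔∩-≤2 : (∀ v → uncovered S v ≡ true → v ∈S F) ⇔ (∀ i → size (F ∩S S i) ≤ 2)
    uncovered-⊆⇔∩-≤2 = mk⇔ to from
      where
      to : (∀ v → uncovered S v ≡ true → v ∈S F) → ∀ i → F∩planes i ≤ 2
      to unc⊆F = ∑-tight 16 2 F∩planes F-meets-planes (≤-reflexive ∑≡32)
        where
        F∩unc≗unc : ∀ v → (mem F v ∧ uncovered S v) ≡ uncovered S v
        F∩unc≗unc v with uncovered S v in unc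
        ... | false = ∧-zeroʳ (mem F v)
        ... | true  = cong (_∧ true) (unc⊆F v unc)
        F∩covered≡17 : F∩covered ≡ 17
        F∩covered≡17 = +-cancelʳ-≡ 15 F∩covered 17
          (trans (cong (F∩covered +_) (sym (trans (count-cong 7 F∩unc≗unc) count-uncovered)))
                 F-split)
        ∑≡32 : ∑[ i < 16 ] F∩planes i ≡ 32
        ∑≡32 = suc-injective (trans (sym F∩covered-∑) (cong (_+ 16) F∩covered≡17))
      from : (∀ i → F∩planes i ≤ 2) → ∀ v → uncovered S v ≡ true → v ∈S F
      from ∩≤2 = count-∧≥⇒⊆ 7 (uncovered S) (mem F) (begin
        count 7 (uncovered S)                   ≡⟨ count-uncovered ⟩
        15                                      ≤⟨ +-cancelˡ-≤ 17 15 F∩uncovered 32≤17+F∩unc ⟩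
        F∩uncovered                             ≡⟨ count-cong 7 (λ v → ∧-comm (mem F v) (uncovered S v)) ⟩
        count 7 (λ v → uncovered S v ∧ mem F v) ∎)
        where
        open ≤-Reasoning
        F∩covered≤17 : F∩covered ≤ 17
        F∩covered≤17 = +-cancelʳ-≤ 16 F∩covered 17
          (subst (_≤ 33) (sym F∩covered-∑) (s≤s (∑-≤-* 16 2 F∩planes ∩≤2)))
        32≤17+F∩unc : 17 + 15 ≤ 17 + F∩uncovered
        32≤17+F∩unc = subst (_≤ 17 + F∩uncovered) F-split (+-monoˡ-≤ F∩uncovered F∩covered≤17)

code⇒spread : (C : Fin 17 → Subspace 7) → IsSubspaceCode 7 17 6 C → ∀ j →
  (∀ i → i ≢ j → HasDim (C i) 3) → IsPartialPlaneSpread 16 (C ∘ punchIn j)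
code⇒spread C (C-injective , dist) j dim3 = dimS , S-injective , trivial
  where
  S : Fin 16 → Subspace 7
  S = C ∘ punchIn j
  dimS : ∀ i → HasDim (S i) 3
  dimS i = dim3 (punchIn j i) (punchInᵢ≢i j i)
  S-injective : ∀ i i′ → S i ≈S S i′ → i ≡ i′
  S-injective i i′ Si≈Si′ = punchIn-injective j i i′ (C-injective _ _ Si≈Si′)
  trivial : PairwiseTrivial S
  trivial i i′ i≢i′ v v∈Sᵢ v∈Sᵢ′ = size-≤1⇒trivial (S i ∩S S i′)
    (DistAtLeast⇒size-∩-≤ {d = 6} {3} {3} {0} (S i) (S i′)
      (dist _ _ (i≢i′ ∘ punchIn-injective j i i′))
      (dimS i) (dimS i′) (n≤1+n 7))
    v (true-∧ v∈Sᵢ v∈Sᵢ′)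

code⇒F∩planes-≤2 : (C : Fin 17 → Subspace 7) → IsSubspaceCode 7 17 6 C → ∀ j →
  HasDim (C j) 5 → (∀ i → i ≢ j → HasDim (C i) 3) → ∀ i → size (C j ∩S C (punchIn j i)) ≤ 2
code⇒F∩planes-≤2 C (_ , dist) j dimF dim3 i =
  DistAtLeast⇒size-∩-≤ {d = 6} {5} {3} {1} (C j) (C (punchIn j i))
    (dist j (punchIn j i) (punchInᵢ≢i j i ∘ sym))
    dimF (dim3 (punchIn j i) (punchInᵢ≢i j i)) (n≤1+n 9)

spread⇒code : (S : Fin 16 → Subspace 7) (F : Subspace 7) → IsPartialPlaneSpread 16 S →
  HasDim F 5 → (∀ i → size (F ∩S S i) ≤ 2) →
  IsSubspaceCode 7 17 6 (F ◂ S) × DimDist3¹⁶5¹ (F ◂ S)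
spread⇒code S F (dimS , S-injective , trivial) dimF F∩S≤2 =
  (T-injective , T-dist) , zero , dimF , dimT
  where
  F≉S : ∀ k → ¬ F ≈S S k
  F≉S k F≈Sk =
    case HasDim-unique (S k) (HasDim-cong {U = F} {W = S k} F≈Sk dimF) (dimS k) of λ ()
  T-injective : ∀ k k′ → (F ◂ S) k ≈S (F ◂ S) k′ → k ≡ k′
  T-injective zero    zero     _ = refl
  T-injective zero    (suc k′) e = contradiction e (F≉S k′)
  T-injective (suc k) zero     e = contradiction (≈S-sym {U = S k} {W = F} e) (F≉S k)
  T-injective (suc k) (suc k′) e = cong suc (S-injective k k′ e)
  T-dist : ∀ k k′ → k ≢ k′ → DistAtLeast 6 ((F ◂ S) k) ((F ◂ S) k′)
  T-dist zero    zero     k≢k′ = contradiction refl k≢k′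
  T-dist zero    (suc k′) _    =
    size-∩⇒DistAtLeast {d = 6} {5} {3} {1} F (S k′) dimF (dimS k′) (F∩S≤2 k′) ≤-refl
  T-dist (suc k) zero     _    =
    size-∩⇒DistAtLeast {d = 6} {3} {5} {1} (S k) F (dimS k) dimF
    (subst (_≤ 2) (size-cong {U = F ∩S S k} {W = S k ∩S F} (∩S-comm F (S k))) (F∩S≤2 k)) ≤-refl
  T-dist (suc k) (suc k′) k≢k′ =
    size-∩⇒DistAtLeast {d = 6} {3} {3} {0} (S k) (S k′) (dimS k) (dimS k′)
    (trivial⇒size-≤1 (S k ∩S S k′) λ v v∈ →
      trivial k k′ (k≢k′ ∘ cong suc) v (proj₁ (∧-true v∈)) (proj₂ (∧-true v∈)))
    ≤-refl
  dimT : ∀ k → k ≢ zero → HasDim ((F ◂ S) k) 3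
  dimT zero    k≢0 = contradiction refl k≢0
  dimT (suc k) _   = dimS k

SpreadUnionHoleSpace : (Fin 17 → Subspace 7) → Set
SpreadUnionHoleSpace C = Σ (Fin 16 → Subspace 7) λ S → Σ (Subspace 7) λ F →
  IsPartialPlaneSpread 16 S × HasDim F 5 × (∀ P → IsHole S P → P ⊆S F) × SameSet C S F

code⇒SpreadUnionHoleSpace : (C : Fin 17 → Subspace 7) →
  IsSubspaceCode 7 17 6 C × DimDist3¹⁶5¹ C → SpreadUnionHoleSpace C
code⇒SpreadUnionHoleSpace C (code , j , dimF , dim3) =
  C ∘ punchIn j , C j , spread , dimF , holes⊆F , SameSet-punchIn C j
  where
  spread : IsPartialPlaneSpread 16 (C ∘ punchIn j)
  spread = code⇒spread C code j dim3
  holes⊆F : ∀ P → IsHole (C ∘ punchIn j) P → P ⊆S C j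
  holes⊆F = Equivalence.from (holes-⊆⇔uncovered-⊆ (C ∘ punchIn j) (C j))
    (Equivalence.from (PlaneSpread.uncovered-⊆⇔∩-≤2 (C ∘ punchIn j) spread (C j) dimF)
      (code⇒F∩planes-≤2 C code j dimF dim3))

SpreadUnionHoleSpace⇒code : (C : Fin 17 → Subspace 7) →
  SpreadUnionHoleSpace C → IsSubspaceCode 7 17 6 C × DimDist3¹⁶5¹ C
SpreadUnionHoleSpace⇒code C (S , F , spread , dimF , holes⊆F , same) =
  C-code , DimDist-relabel C (F ◂ S) relabel (proj₁ C-code) (proj₂ F◂S-code)
  where
  relabel : Relabelling C (F ◂ S)
  relabel = SameSet⇒Relabelling C S F same
  F◂S-code : IsSubspaceCode 7 17 6 (F ◂ S) × DimDist3¹⁶5¹ (F ◂ S)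
  F◂S-code = spread⇒code S F spread dimF
    (Equivalence.to (PlaneSpread.uncovered-⊆⇔∩-≤2 S spread F dimF)
      (Equivalence.to (holes-⊆⇔uncovered-⊆ S F) holes⊆F))
  C-code : IsSubspaceCode 7 17 6 C
  C-code = IsSubspaceCode-relabel {d = 6} C (F ◂ S) relabel (proj₁ F◂S-code)

lemma6p4 : (C : Fin 17 → Subspace 7) →
    (IsSubspaceCode 7 17 6 C × DimDist3¹⁶5¹ C) ⇔
      (Σ (Fin 16 → Subspace 7) λ S16 → Σ (Subspace 7) λ F →
        IsPartialPlaneSpread 16 S16 × HasDim F 5 ×
        (∀ P → IsHole S16 P → P ⊆S F) × SameSet C S16 F)
lemma6p4 C = mk⇔ (code⇒SpreadUnionHoleSpace C) (SpreadUnionHoleSpace⇒code C)
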